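{- Let $\pi=\pi_1\cdots\pi_n\in\mathfrak{S}_n$. If $\beta\in\mathcal{O}^{ -1}(\pi)$ has a block consisting of a repeated value $i\,i$ (i.e. the value $i$ occurs twice in $\beta$), then $\pi_i<\pi_{i+1}$, i.e. $\pi$ has an ascent at index $i$.
   Context: $[n]=\{1,\ldots,n\}$. Parking process: $\alpha=(a_1,\ldots,a_n)\in[n]^n$ encodes preferences of cars $1,\ldots,n$ arriving in order at a one-way street with spots $1,\ldots,n$; car $i$ parks in spot $a_i$ if free, otherwise in the first free spot after $a_i$, if any. $\alpha$ is a parking function if all cars park. A unit interval parking function is a parking function in which each car $i$ parks in spot $a_i$ or $a_i+1$. A Fubini ranking is a tuple $(r_1,\ldots,r_n)\in[n]^n$ with $r_i=1+|\{j:r_j<r_i\}|$ for all $i$. $\mathrm{UFR}_n$ is the set of tuples that are both Fubini rankings and unit interval parking functions. Block structure: with weakly increasing rearrangement $\alpha'=(a'_1,\ldots,a'_n)$, let $i_1<\cdots<i_m$ be all indices with $a'_{i_j}=i_j$, $i_{m+1}=n+1$, and blocks $b_j=(a'_{i_j},\ldots,a'_{i_{j+1}-1})$. The outcome map $\mathcal{O}:\mathrm{UFR}_n\to\mathfrak{S}_n$ sends $\alpha$ to $\pi_1\cdots\pi_n$ where $\pi_j$ is the car parked in spot $j$; $\mathcal{O}^{ -1}(\pi)=\{\alpha\in\mathrm{UFR}_n:\mathcal{O}(\alpha)=\pi\}$. -}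

module Defs where

open import Data.Nat using (ℕ; zero; suc; _+_; _≤_; _<_; _≤ᵇ_; _<?_)
open import Data.Nat.Properties using (≤-decTotalOrder)
open import Data.Bool using (Bool; true; false; _∧_; if_then_else_)
open import Data.List using (List; []; _∷_; length; replicate; filter; map)
open import Data.List.Relation.Unary.All using (All)
open import Data.List.Relation.Binary.Pointwise using (Pointwise)
open import Data.Maybe using (Maybe; just; nothing)
open import Data.Product using (_×_; _,_; Σ; ∃; ∃-syntax)
open import Data.Sum using (_⊎_)
open import Relation.Binary.PropositionalEquality using (_≡_)
import Data.List.Sort.MergeSort

-- Conventions: a tuple (a₁,…,aₙ) is a List ℕ of length n; everything is 1-based.

-- 1-based lookup (returns 0 out of range; only used in range)
at : List ℕ → ℕ → ℕ
at []       _             = 0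
at (x ∷ xs) zero          = 0
at (x ∷ xs) (suc zero)    = x
at (x ∷ xs) (suc (suc k)) = at xs (suc k)

oneTo : ℕ → List ℕ
oneTo zero    = []
oneTo (suc n) = Data.List._++_ (oneTo n) (suc n ∷ [])

InRange : ℕ → List ℕ → Set
InRange n α = length α ≡ n × All (λ a → 1 ≤ a × a ≤ n) α

-- Parking process. The street is a list of n spots, entry 0 = empty,
-- entry c ≥ 1 = car c parked there.

isZero : ℕ → Bool
isZero zero    = true
isZero (suc _) = false

-- first free spot with (1-based) index ≥ a; k is the index of the head
firstFreeFrom : ℕ → List ℕ → ℕ → Maybe ℕ
firstFreeFrom k []       a = nothing
firstFreeFrom k (x ∷ xs) a =
  if (a ≤ᵇ k) ∧ isZero x then just k else firstFreeFrom (suc k) xs a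

firstFree : List ℕ → ℕ → Maybe ℕ
firstFree street a = firstFreeFrom 1 street a

setSpot : List ℕ → ℕ → ℕ → List ℕ
setSpot []       _             c = []
setSpot (x ∷ xs) zero          c = x ∷ xs
setSpot (x ∷ xs) (suc zero)    c = c ∷ xs
setSpot (x ∷ xs) (suc (suc k)) c = x ∷ setSpot xs (suc k) c

-- cars c, c+1, … with the given preferences arrive in order.
-- Returns nothing if some car fails to park; otherwise the final street
-- and the list of spots taken by each car (in car order).
parkFrom : ℕ → List ℕ → List ℕ → Maybe (List ℕ × List ℕ)
parkFrom c street []       = just (street , [])
parkFrom c street (a ∷ as) with firstFree street a
... | nothing = nothing
... | just s with parkFrom (suc c) (setSpot street s c) as
...   | nothing             = nothing
...   | just (final , ss)   = just (final , s ∷ ss)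

park : ℕ → List ℕ → Maybe (List ℕ × List ℕ)
park n α = parkFrom 1 (replicate n 0) α

IsParkingFunction : ℕ → List ℕ → Set
IsParkingFunction n α = InRange n α × ∃[ r ] park n α ≡ just r

IsUnitIntervalPF : ℕ → List ℕ → Set
IsUnitIntervalPF n α =
  InRange n α ×
  ∃[ street ] ∃[ spots ]
    (park n α ≡ just (street , spots) ×
     Pointwise (λ a s → s ≡ a ⊎ s ≡ suc a) α spots)

IsFubiniRanking : ℕ → List ℕ → Set
IsFubiniRanking n r =
  InRange n r × All (λ x → x ≡ suc (length (filter (_<? x) r))) r

UFR : ℕ → List ℕ → Set
UFR n α = IsFubiniRanking n α × IsUnitIntervalPF n α

-- outcome map: 𝒪(α) = π iff the parking process ends with car π_j in spot j
Outcome : ℕ → List ℕ → List ℕ → Set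
Outcome n α π = ∃[ spots ] park n α ≡ just (π , spots)

open import Data.List.Relation.Binary.Permutation.Propositional using (_↭_)
IsPerm : ℕ → List ℕ → Set
IsPerm n π = π ↭ oneTo n

open Data.List.Sort.MergeSort ≤-decTotalOrder using (sort)

rearr : List ℕ → List ℕ
rearr = sort

slice : List ℕ → ℕ → ℕ → List ℕ
slice xs s zero    = []
slice xs s (suc k) = at xs s ∷ slice xs (suc s) k

IsStart : List ℕ → ℕ → Set
IsStart α' k = 1 ≤ k × k ≤ length α' × at α' k ≡ k

-- b is a block of α: b = (a'_{i_j}, …, a'_{i_{j+1}-1}) for consecutive
-- starts i_j < i_{j+1} (where i_{m+1} = n+1)
HasBlock : List ℕ → List ℕ → Set
HasBlock α b =
  let α' = rearr α in
  Σ ℕ λ s → Σ ℕ λ e →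
    IsStart α' s × s < e ×
    (IsStart α' e ⊎ e ≡ suc (length α')) ×
    ((k : ℕ) → s < k → k < e → at α' k ≡ k → Data.Empty.⊥) ×
    b ≡ slice α' s (e Data.Nat.∸ s)
  where import Data.Empty

-- A block i i of the sorted preferences means that two cars, say p < q, both prefer spot i.
-- Being unit interval, they park in i or i + 1, so they fill exactly these two spots.
-- Were p displaced to i + 1, spot i would already hold a car arriving before p, not q;
-- so p parks in spot i and q in spot i + 1, and π_i = p < q = π_{i+1}.
module Submission where

open import Defs
open import Data.Bool using (true; false; T)
open import Data.Bool.Properties using (∧-zeroʳ)
open import Data.Empty using (⊥-elim)
open import Data.List using (List; []; _∷_; length; replicate; filter)
open import Data.List.Properties using (filter-accept; filter-reject)
open import Data.List.Relation.Binary.Permutation.Propositional using (_↭_)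
open import Data.List.Relation.Binary.Permutation.Propositional.Properties using (↭-length; filter-↭)
open import Data.List.Relation.Binary.Pointwise using (Pointwise; []; _∷_)
open import Data.Maybe using (just; nothing)
open import Data.Maybe.Properties using (just-injective)
open import Data.Nat using (ℕ; zero; suc; _+_; _∸_; _<_; _≤_; z≤n; s≤s; _≤ᵇ_; _≟_)
open import Data.Nat.Properties
open import Data.List.Sort.MergeSort.Properties ≤-decTotalOrder using (sort-↭)
open import Data.Product using (_×_; _,_; proj₁; proj₂; ∃-syntax)
open import Data.Sum using (_⊎_; inj₁; inj₂)
open import Data.Unit using (tt)
open import Function using (_∘_)
open import Relation.Binary.PropositionalEquality
open import Relation.Nullary using (yes; no)

at-replicate-0 : ∀ n t → at (replicate n 0) t ≡ 0
at-replicate-0 zero          t             = refl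
at-replicate-0 (suc n)       zero          = refl
at-replicate-0 (suc n)       (suc zero)    = refl
at-replicate-0 (suc n)       (suc (suc t)) = at-replicate-0 n (suc t)

at-setSpot-≡ : ∀ l j c → j < length l → at (setSpot l (suc j) c) (suc j) ≡ c
at-setSpot-≡ (x ∷ l) zero    c _         = refl
at-setSpot-≡ (x ∷ l) (suc j) c (s≤s j<l) = at-setSpot-≡ l j c j<l

at-setSpot-≢ : ∀ l s t c → t ≢ s → at (setSpot l s c) t ≡ at l t
at-setSpot-≢ []      s             t             c t≢s = refl
at-setSpot-≢ (x ∷ l) zero          t             c t≢s = refl
at-setSpot-≢ (x ∷ l) (suc zero)    zero          c t≢s = refl
at-setSpot-≢ (x ∷ l) (suc zero)    (suc zero)    c t≢s = ⊥-elim (t≢s refl)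
at-setSpot-≢ (x ∷ l) (suc zero)    (suc (suc t)) c t≢s = refl
at-setSpot-≢ (x ∷ l) (suc (suc s)) zero          c t≢s = refl
at-setSpot-≢ (x ∷ l) (suc (suc s)) (suc zero)    c t≢s = refl
at-setSpot-≢ (x ∷ l) (suc (suc s)) (suc (suc t)) c t≢s =
  at-setSpot-≢ l (suc s) (suc t) c (t≢s ∘ cong suc)

at-setSpot : ∀ l s t c → at (setSpot l s c) t ≡ at l t ⊎ at (setSpot l s c) t ≡ c
at-setSpot []      s             t             c = inj₁ refl
at-setSpot (x ∷ l) zero          t             c = inj₁ refl
at-setSpot (x ∷ l) (suc zero)    zero          c = inj₁ refl
at-setSpot (x ∷ l) (suc zero)    (suc zero)    c = inj₂ refl
at-setSpot (x ∷ l) (suc zero)    (suc (suc t)) c = inj₁ refl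
at-setSpot (x ∷ l) (suc (suc s)) zero          c = inj₁ refl
at-setSpot (x ∷ l) (suc (suc s)) (suc zero)    c = inj₁ refl
at-setSpot (x ∷ l) (suc (suc s)) (suc (suc t)) c = at-setSpot l (suc s) (suc t) c

firstFreeFrom-step : ∀ k x xs a →
  (firstFreeFrom k (x ∷ xs) a ≡ just k × x ≡ 0) ⊎
  firstFreeFrom k (x ∷ xs) a ≡ firstFreeFrom (suc k) xs a
firstFreeFrom-step k zero    xs a with a ≤ᵇ k
... | true  = inj₁ (refl , refl)
... | false = inj₂ refl
firstFreeFrom-step k (suc x) xs a rewrite ∧-zeroʳ (a ≤ᵇ k) = inj₂ refl

-- firstFreeFrom k xs treats xs as the spots from k on: spot k + j is the entry at xs (suc j).
firstFreeFrom-free : ∀ k xs a {s} → firstFreeFrom k xs a ≡ just s →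
                     ∃[ j ] s ≡ k + j × j < length xs × at xs (suc j) ≡ 0
firstFreeFrom-free k []       a ()
firstFreeFrom-free k (x ∷ xs) a found with firstFreeFrom-step k x xs a
... | inj₁ (here , x≡0) =
  0 , sym (trans (+-identityʳ k) (just-injective (trans (sym here) found))) , s≤s z≤n , x≡0
... | inj₂ next with firstFreeFrom-free (suc k) xs a (trans (sym next) found)
...   | j , s≡k+1+j , j<xs , free = suc j , trans s≡k+1+j (sym (+-suc k j)) , s≤s j<xs , free

firstFreeFrom-occupied : ∀ k xs j {s} → firstFreeFrom k xs (k + j) ≡ just s → s ≢ k + j →
                         at xs (suc j) ≢ 0
firstFreeFrom-occupied k []            j       ()
firstFreeFrom-occupied k (suc x ∷ xs)  zero    _     _   = λ ()
firstFreeFrom-occupied k (zero ∷ xs)   zero    found s≢a with k + 0 ≤ᵇ k in a≤ᵇk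
... | true  = ⊥-elim (s≢a (trans (sym (just-injective found)) (sym (+-identityʳ k))))
... | false = ⊥-elim (subst T a≤ᵇk (≤⇒≤ᵇ (≤-reflexive (+-identityʳ k))))
firstFreeFrom-occupied k (x ∷ xs)      (suc j) found s≢a
  rewrite +-suc k j with suc (k + j) ≤ᵇ k in a≤ᵇk
... | true  = ⊥-elim (≤⇒≯ (m≤m+n k j) (≤ᵇ⇒≤ _ k (subst T (sym a≤ᵇk) tt)))
... | false = firstFreeFrom-occupied (suc k) xs j found s≢a

parkFrom-∷⁻ : ∀ c street a as {final ss} → parkFrom c street (a ∷ as) ≡ just (final , ss) →
  ∃[ s ] ∃[ ss′ ] firstFree street a ≡ just s × ss ≡ s ∷ ss′ ×
                  parkFrom (suc c) (setSpot street s c) as ≡ just (final , ss′)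
parkFrom-∷⁻ c street a as parked with firstFree street a
... | nothing with () ← parked
... | just s with parkFrom (suc c) (setSpot street s c) as in rest
...   | nothing with () ← parked
...   | just (_ , ss′) with refl ← parked = s , ss′ , refl , refl , rest

parkFrom-keeps-occupied : ∀ c street as {final ss} → parkFrom c street as ≡ just (final , ss) →
                          ∀ t → at street t ≢ 0 → at final t ≡ at street t
parkFrom-keeps-occupied c street []       refl t occupied = refl
parkFrom-keeps-occupied c street (a ∷ as) parked t occupied
  with parkFrom-∷⁻ c street _ as parked
... | s , _ , found , refl , rest
  with firstFreeFrom-free 1 street a found
... | j , refl , _ , free =
  trans (parkFrom-keeps-occupied _ _ as rest t (occupied ∘ trans (sym unchanged))) unchanged
  where
    unchanged : at (setSpot street (suc j) c) t ≡ at street t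
    unchanged = at-setSpot-≢ street (suc j) t c λ { refl → occupied free }

parkFrom-places : ∀ c street as {final ss} → parkFrom (suc c) street as ≡ just (final , ss) →
                  ∀ p → p < length as → at final (at ss (suc p)) ≡ suc c + p
parkFrom-places c street (a ∷ as) parked p p<as with parkFrom-∷⁻ (suc c) street _ as parked
parkFrom-places c street (a ∷ as) {final} parked zero _ | s , _ , found , refl , rest
  with firstFreeFrom-free 1 street a found
... | j , refl , j<street , _ = begin
  at final (suc j)                            ≡⟨ parkFrom-keeps-occupied _ _ as rest (suc j) occupied ⟩
  at (setSpot street (suc j) (suc c)) (suc j) ≡⟨ car ⟩
  suc c                                       ≡⟨ +-identityʳ (suc c) ⟨
  suc c + 0                                   ∎
  where
    open ≡-Reasoning
    car : at (setSpot street (suc j) (suc c)) (suc j) ≡ suc c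
    car = at-setSpot-≡ street j (suc c) j<street
    occupied : at (setSpot street (suc j) (suc c)) (suc j) ≢ 0
    occupied = 1+n≢0 ∘ trans (sym car)
parkFrom-places c street (a ∷ as) parked (suc p) (s≤s p<as) | _ , _ , _ , refl , rest =
  trans (parkFrom-places _ _ as rest p p<as) (sym (+-suc (suc c) p))

parkFrom-displaced : ∀ c street as {final ss} → (∀ t → at street t < c) →
                     parkFrom c street as ≡ just (final , ss) →
                     ∀ p {a} → at as (suc p) ≡ suc a → at ss (suc p) ≢ suc a →
                     at final (suc a) < c + p
parkFrom-displaced c street [] _ _ p ()
parkFrom-displaced c street (_ ∷ as) {final} below parked zero {a} refl displaced
  with parkFrom-∷⁻ c street _ as parked
... | _ , _ , found , refl , _ = begin-strict
  at final (suc a)  ≡⟨ parkFrom-keeps-occupied c street _ parked (suc a) occupied ⟩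
  at street (suc a) <⟨ below (suc a) ⟩
  c                 ≡⟨ +-identityʳ c ⟨
  c + 0             ∎
  where
    open ≤-Reasoning
    occupied : at street (suc a) ≢ 0
    occupied = firstFreeFrom-occupied 1 street a found displaced
parkFrom-displaced c street (b ∷ as) {final} below parked (suc p) {a} pref displaced
  with parkFrom-∷⁻ c street _ as parked
... | s , _ , _ , refl , rest =
  subst (at final (suc a) <_) (sym (+-suc c p)) (parkFrom-displaced _ _ as below′ rest p pref displaced)
  where
    below′ : ∀ t → at (setSpot street s c) t < suc c
    below′ t with at-setSpot street s t c
    ... | inj₁ old = subst (_< suc c) (sym old) (m<n⇒m<1+n (below t))
    ... | inj₂ new = subst (_< suc c) (sym new) (n<1+n c)

at-nonzero⇒<length : ∀ xs q → at xs (suc q) ≢ 0 → q < length xs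
at-nonzero⇒<length []       q       nonzero = ⊥-elim (nonzero refl)
at-nonzero⇒<length (x ∷ xs) zero    _       = s≤s z≤n
at-nonzero⇒<length (x ∷ xs) (suc q) nonzero = s≤s (at-nonzero⇒<length xs q nonzero)

Pointwise-at : ∀ {R : ℕ → ℕ → Set} {xs ys} → Pointwise R xs ys →
               ∀ p → p < length xs → R (at xs (suc p)) (at ys (suc p))
Pointwise-at (r ∷ _)  zero    _         = r
Pointwise-at (_ ∷ rs) (suc p) (s≤s p<n) = Pointwise-at rs p p<n

multiplicity : ℕ → List ℕ → ℕ
multiplicity v xs = length (filter (_≟ v) xs)

multiplicity-↭ : ∀ v {xs ys} → xs ↭ ys → multiplicity v xs ≡ multiplicity v ys
multiplicity-↭ v = ↭-length ∘ filter-↭ (_≟ v)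

-- Positions are counted from 0: position p holds the entry at xs (suc p).
record OccursTwice (v : ℕ) (xs : List ℕ) : Set where
  constructor occursTwice
  field
    first second  : ℕ
    first<second  : first < second
    second<length : second < length xs
    at-first      : at xs (suc first) ≡ v
    at-second     : at xs (suc second) ≡ v

multiplicity-∷-≡ : ∀ {v x} xs → x ≡ v → multiplicity v (x ∷ xs) ≡ suc (multiplicity v xs)
multiplicity-∷-≡ {v} _ x≡v = cong length (filter-accept (_≟ v) x≡v)

multiplicity-∷-≢ : ∀ {v x} xs → x ≢ v → multiplicity v (x ∷ xs) ≡ multiplicity v xs
multiplicity-∷-≢ {v} _ x≢v = cong length (filter-reject (_≟ v) x≢v)

multiplicity-∷ : ∀ v x xs → multiplicity v xs ≤ multiplicity v (x ∷ xs)
multiplicity-∷ v x xs with x ≟ v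
... | yes x≡v = ≤-trans (n≤1+n _) (≤-reflexive (sym (multiplicity-∷-≡ xs x≡v)))
... | no x≢v  = ≤-reflexive (sym (multiplicity-∷-≢ xs x≢v))

occurs⇒1≤multiplicity : ∀ {v} xs q → q < length xs → at xs (suc q) ≡ v → 1 ≤ multiplicity v xs
occurs⇒1≤multiplicity (x ∷ xs) zero    _          x≡v  =
  subst (1 ≤_) (sym (multiplicity-∷-≡ xs x≡v)) (s≤s z≤n)
occurs⇒1≤multiplicity (x ∷ xs) (suc q) (s≤s q<xs) at≡v =
  ≤-trans (occurs⇒1≤multiplicity xs q q<xs at≡v) (multiplicity-∷ _ x xs)

1≤multiplicity⇒occurs : ∀ v xs → 1 ≤ multiplicity v xs → ∃[ q ] q < length xs × at xs (suc q) ≡ v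
1≤multiplicity⇒occurs v (x ∷ xs) 1≤m with x ≟ v
... | yes x≡v = 0 , s≤s z≤n , x≡v
... | no x≢v with 1≤multiplicity⇒occurs v xs (subst (1 ≤_) (multiplicity-∷-≢ xs x≢v) 1≤m)
...   | q , q<xs , at≡v = suc q , s≤s q<xs , at≡v

occursTwice-∷ : ∀ {v xs} x → OccursTwice v xs → OccursTwice v (x ∷ xs)
occursTwice-∷ x (occursTwice p q p<q q<xs at-p at-q) =
  occursTwice (suc p) (suc q) (s≤s p<q) (s≤s q<xs) at-p at-q

occursTwice⇒2≤multiplicity : ∀ {v} xs → OccursTwice v xs → 2 ≤ multiplicity v xs
occursTwice⇒2≤multiplicity (x ∷ xs) (occursTwice zero (suc q) _ (s≤s q<xs) x≡v at-q) =
  subst (2 ≤_) (sym (multiplicity-∷-≡ xs x≡v)) (s≤s (occurs⇒1≤multiplicity xs q q<xs at-q))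
occursTwice⇒2≤multiplicity (x ∷ xs) (occursTwice (suc p) (suc q) (s≤s p<q) (s≤s q<xs) at-p at-q) =
  ≤-trans (occursTwice⇒2≤multiplicity xs (occursTwice p q p<q q<xs at-p at-q)) (multiplicity-∷ _ x xs)

2≤multiplicity⇒occursTwice : ∀ v xs → 2 ≤ multiplicity v xs → OccursTwice v xs
2≤multiplicity⇒occursTwice v (x ∷ xs) 2≤m with x ≟ v
... | yes x≡v with 1≤multiplicity⇒occurs v xs (≤-pred (subst (2 ≤_) (multiplicity-∷-≡ xs x≡v) 2≤m))
...   | q , q<xs , at≡v = occursTwice 0 (suc q) (s≤s z≤n) (s≤s q<xs) x≡v at≡v
2≤multiplicity⇒occursTwice v (x ∷ xs) 2≤m | no x≢v =
  occursTwice-∷ x (2≤multiplicity⇒occursTwice v xs (subst (2 ≤_) (multiplicity-∷-≢ xs x≢v) 2≤m))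

occursTwice-↭ : ∀ {v xs ys} → xs ↭ ys → OccursTwice v xs → OccursTwice v ys
occursTwice-↭ {v} {xs} {ys} xs↭ys twice =
  2≤multiplicity⇒occursTwice v ys
    (subst (2 ≤_) (multiplicity-↭ v xs↭ys) (occursTwice⇒2≤multiplicity xs twice))

slice-pair : ∀ xs s d {x y} → x ∷ y ∷ [] ≡ slice xs s d → x ≡ at xs s × y ≡ at xs (suc s)
slice-pair xs s zero                ()
slice-pair xs s (suc zero)          ()
slice-pair xs s (suc (suc zero))    refl = refl , refl
slice-pair xs s (suc (suc (suc d))) ()

repeatedBlock⇒occursTwice : ∀ β i → HasBlock β (i ∷ i ∷ []) → 1 ≤ i × OccursTwice i (rearr β)
repeatedBlock⇒occursTwice β i (zero , _ , (() , _) , _)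
repeatedBlock⇒occursTwice β i (suc s , e , (_ , _ , start) , _ , _ , _ , block)
  with slice-pair (rearr β) (suc s) (e ∸ suc s) block
... | refl , i≡at =
  1≤i , occursTwice s (suc s) (n<1+n s) (at-nonzero⇒<length (rearr β) (suc s) at≢0) refl (sym i≡at)
  where
    1≤i : 1 ≤ at (rearr β) (suc s)
    1≤i = subst (1 ≤_) (sym start) (s≤s z≤n)
    at≢0 : at (rearr β) (suc (suc s)) ≢ 0
    at≢0 eq = 1+n≢0 (trans (sym start) (trans i≡at eq))

park-places : ∀ n β {π spots} → park n β ≡ just (π , spots) →
              ∀ p → p < length β → at π (at spots (suc p)) ≡ suc p
park-places n β = parkFrom-places 0 (replicate n 0) β

sharedPreference-spots : ∀ n β {π spots i} → park n β ≡ just (π , spots) →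
  Pointwise (λ a s → s ≡ a ⊎ s ≡ suc a) β spots → 1 ≤ i → (twice : OccursTwice i β) →
  at spots (suc (OccursTwice.first twice)) ≡ i × at spots (suc (OccursTwice.second twice)) ≡ suc i
sharedPreference-spots n β {π} {spots} {suc a} parked unit (s≤s z≤n) twice =
  spots-of (preferred first first<length at-first) (preferred second second<length at-second)
  where
    open OccursTwice twice
    first<length : first < length β
    first<length = <-trans first<second second<length
    distinct : at spots (suc first) ≢ at spots (suc second)
    distinct eq = <⇒≢ first<second (suc-injective (begin
      suc first                    ≡⟨ park-places n β parked first first<length ⟨
      at π (at spots (suc first))  ≡⟨ cong (at π) eq ⟩
      at π (at spots (suc second)) ≡⟨ park-places n β parked second second<length ⟩
      suc second                   ∎))
      where open ≡-Reasoning
    preferred : ∀ p → p < length β → at β (suc p) ≡ suc a →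
                at spots (suc p) ≡ suc a ⊎ at spots (suc p) ≡ suc (suc a)
    preferred p p<β at≡ =
      subst (λ v → at spots (suc p) ≡ v ⊎ at spots (suc p) ≡ suc v) at≡ (Pointwise-at unit p p<β)
    empty : ∀ t → at (replicate n 0) t < 1
    empty t = subst (_< 1) (sym (at-replicate-0 n t)) (s≤s z≤n)
    late : at spots (suc first) ≢ suc a → at π (suc a) < suc first
    late = parkFrom-displaced 1 (replicate n 0) β empty parked first at-first
    spots-of : at spots (suc first) ≡ suc a ⊎ at spots (suc first) ≡ suc (suc a) →
               at spots (suc second) ≡ suc a ⊎ at spots (suc second) ≡ suc (suc a) →
               at spots (suc first) ≡ suc a × at spots (suc second) ≡ suc (suc a)
    spots-of (inj₁ first≡a)   (inj₁ second≡a)   = ⊥-elim (distinct (trans first≡a (sym second≡a)))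
    spots-of (inj₁ first≡a)   (inj₂ second≡a+1) = first≡a , second≡a+1
    spots-of (inj₂ first≡a+1) (inj₁ second≡a)   =
      ⊥-elim (<-asym first<second (≤-pred (subst (_< suc first) second-at-a (late first≢a))))
      where
        first≢a : at spots (suc first) ≢ suc a
        first≢a eq = 1+n≢n (trans (sym first≡a+1) eq)
        second-at-a : at π (suc a) ≡ suc second
        second-at-a =
          trans (cong (at π) (sym second≡a)) (park-places n β parked second second<length)
    spots-of (inj₂ first≡a+1) (inj₂ second≡a+1) =
      ⊥-elim (distinct (trans first≡a+1 (sym second≡a+1)))

sharedPreference⇒ascent : ∀ n β {π spots i} → park n β ≡ just (π , spots) →
  Pointwise (λ a s → s ≡ a ⊎ s ≡ suc a) β spots → 1 ≤ i → OccursTwice i β →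
  at π i < at π (suc i)
sharedPreference⇒ascent n β {π} {spots} {i} parked unit 1≤i twice = begin-strict
  at π i                       ≡⟨ cong (at π) spot-first ⟨
  at π (at spots (suc first))  ≡⟨ park-places n β parked first (<-trans first<second second<length) ⟩
  suc first                    <⟨ s≤s first<second ⟩
  suc second                   ≡⟨ park-places n β parked second second<length ⟨
  at π (at spots (suc second)) ≡⟨ cong (at π) spot-second ⟩
  at π (suc i)                 ∎
  where
    open ≤-Reasoning
    open OccursTwice twice
    spot-first : at spots (suc first) ≡ i
    spot-first = proj₁ (sharedPreference-spots n β parked unit 1≤i twice)
    spot-second : at spots (suc second) ≡ suc i
    spot-second = proj₂ (sharedPreference-spots n β parked unit 1≤i twice)

lemma4p4 : (n : ℕ) (π β : List ℕ) → IsPerm n π → UFR n β → Outcome n β π →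
    (i : ℕ) → HasBlock β (i ∷ i ∷ []) → at π i < at π (suc i)
lemma4p4 n π β _ (_ , _ , _ , spots , parked , unit) (_ , outcome) i block
  with refl ← just-injective (trans (sym outcome) parked)
     | 1≤i , twiceSorted ← repeatedBlock⇒occursTwice β i block
  = sharedPreference⇒ascent n β parked unit 1≤i (occursTwice-↭ (sort-↭ β) twiceSorted)
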